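{- Let $k$ be even with $1<k\le n$. There is a nondeterministic OBDD on $n$ variables computing $\mathtt{NotO^k_{n}}$ whose width $d$ satisfies $d=O(\log^2 k\,\log\log k)$.
   Context: $\log$ is base $2$. For $\nu\in\{0,1\}^n$ let $\#^k_0(\nu)$, $\#^k_1(\nu)$ be the numbers of zeros and ones among the first $k$ bits. $\mathtt{NotO^k_{n}}(\nu)=0$ if $\#^k_0(\nu)=\#^k_1(\nu)=k/2$ and $1$ otherwise. A nondeterministic OBDD on $x_1,\dots,x_n$ with order $\pi$ (a permutation of $\{1,\dots,n\}$) is a leveled directed acyclic graph with levels $0,\dots,n$, a single source at level $0$, each node at level $j-1$ having any number of outgoing edges labelled $0$ or $1$ to nodes at level $j$, and nodes at level $n$ marked accepting or rejecting; it outputs $1$ on $\nu$ iff some path from the source that at step $j$ follows an edge labelled $\nu_{\pi(j)}$ ends at an accepting node. Width is the maximum number of nodes in a level. -}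

module Defs where

open import Data.Nat using (ℕ; zero; suc; _+_; _*_; _^_; _≤_; _<ᵇ_; _≡ᵇ_; _⊔_; ⌊_/2⌋)
open import Data.Nat.Logarithm using (⌊log₂_⌋)
open import Data.Bool using (Bool; true; false; _∧_; if_then_else_; not)
open import Data.Fin using (Fin; zero; suc; toℕ; inject₁; fromℕ)
open import Data.Fin.Permutation using (Permutation′; _⟨$⟩ʳ_)
open import Data.Product using (Σ; _×_)
open import Relation.Binary.PropositionalEquality using (_≡_)
open import Function.Bundles using (_⇔_)

-- An input: ν ∈ {0,1}^n, with bit x_{i+1} = ν i, true ≙ 1.
Input : ℕ → Set
Input n = Fin n → Bool

countF : (m : ℕ) → (Fin m → Bool) → ℕ
countF zero    P = 0
countF (suc m) P = (if P zero then 1 else 0) + countF m (λ i → P (suc i))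

#1 : {n : ℕ} → ℕ → Input n → ℕ
#1 {n} k ν = countF n (λ i → (toℕ i <ᵇ k) ∧ ν i)

#0 : {n : ℕ} → ℕ → Input n → ℕ
#0 {n} k ν = countF n (λ i → (toℕ i <ᵇ k) ∧ not (ν i))

NotO : (n k : ℕ) → Input n → Bool
NotO n k ν = not ((#0 k ν ≡ᵇ ⌊ k /2⌋) ∧ (#1 k ν ≡ᵇ ⌊ k /2⌋))

-- Step j (from level j to level j+1) reads
-- variable x_{π(j)}; edge j u b v = true iff there is an edge labelled b from u to v.
record NOBDD (n : ℕ) : Set where
  field
    order      : Permutation′ n
    size       : Fin (suc n) → ℕ
    singleSrc  : size zero ≡ 1
    edge       : (j : Fin n) → Fin (size (inject₁ j)) → Bool → Fin (size (suc j)) → Bool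
    accepting  : Fin (size (fromℕ n)) → Bool

  AcceptingPath : Input n → Set
  AcceptingPath ν =
    Σ ((j : Fin (suc n)) → Fin (size j)) λ p →
      ((j : Fin n) → edge j (p (inject₁ j)) (ν (order ⟨$⟩ʳ j)) (p (suc j)) ≡ true)
      × (accepting (p (fromℕ n)) ≡ true)

  -- (the path starts at the source automatically: level 0 has exactly one node)

maxF : (m : ℕ) → (Fin m → ℕ) → ℕ
maxF zero    f = 0
maxF (suc m) f = f zero ⊔ maxF m (λ i → f (suc i))

width : {n : ℕ} → NOBDD n → ℕ
width {n} B = maxF (suc n) (NOBDD.size B)

Computes : {n : ℕ} → NOBDD n → (Input n → Bool) → Set
Computes B f = ∀ ν → (f ν ≡ true) ⇔ NOBDD.AcceptingPath B ν

-- Guess one of the moduli M+1, …, 2M+1 (M = ⌊log k⌋) on the first edge and count the ones among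
-- the first k bits modulo it, accepting iff the count differs from k/2 modulo the guess; this needs
-- (M+1)(2M+1) = O(log² k) nodes per level. If #1 = k/2 (equivalently #0 = #1 = k/2, as k is even) every
-- guess rejects. Otherwise 0 < ∣#1 − k/2∣ ≤ k/2 < 2^M, whereas a positive common multiple D of
-- M+1, …, 2M+1 satisfies 2^M·M! ≤ (M+1)⋯(2M+1) ≤ M!·D, because (M+1)⋯(2M+1) divides M!·D;
-- so some guess accepts.
module Submission where

open import Defs
open import Data.Nat using (ℕ; _*_; _^_; _≤_; _<_)
open import Data.Nat.Logarithm using (⌊log₂_⌋)
open import Data.Product using (Σ; _×_)
open import Data.Nat.Divisibility using (_∣_)

open import Data.Nat
open import Data.Nat.Properties
open import Data.Nat.DivMod
open import Data.Nat.Divisibility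
open import Data.Nat.Logarithm
open import Data.Nat.Solver using (module +-*-Solver)
open import Data.Bool using (Bool; true; false; _∧_; not; if_then_else_)
open import Data.Bool.Properties using (∧-zeroʳ; T-≡; not-¬)
open import Data.Fin as Fin using (Fin; zero; suc; toℕ; inject₁; fromℕ; fromℕ<; combine; remQuot)
open import Data.Fin.Properties using (remQuot-combine; toℕ-fromℕ<; toℕ≤pred[n]; ¬∀⟶∃¬)
open import Data.Fin.Induction using (<-weakInduction)
open import Data.Fin.Permutation using (id)
open import Data.Product
open import Data.Sum using (inj₁; inj₂)
open import Data.Empty using (⊥-elim)
open import Function using (_∘_; const)
open import Function.Bundles using (_⇔_; mk⇔; Equivalence)
import Function.Properties.Equivalence as ⇔
open import Relation.Binary.PropositionalEquality
open import Relation.Nullary using (Dec; yes; no; ¬?; _×-dec_; isYes; contradiction)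
open +-*-Solver using (solve; _:=_; _:+_; _:*_; con)

risingProduct : ℕ → ℕ → ℕ
risingProduct x zero    = x
risingProduct x (suc k) = risingProduct x k * (x + suc k)

risingProduct-suc : ∀ x k → risingProduct x (suc k) ≡ x * risingProduct (suc x) k
risingProduct-suc x zero    = cong (x *_) (+-comm x 1)
risingProduct-suc x (suc k) = begin
  risingProduct x (suc k) * (x + suc (suc k))        ≡⟨ cong₂ _*_ (risingProduct-suc x k) (+-suc x (suc k)) ⟩
  x * risingProduct (suc x) k * (suc x + suc k)      ≡⟨ *-assoc x _ _ ⟩
  x * risingProduct (suc x) (suc k)                  ∎
  where open ≡-Reasoning

-- The two factorisations x ⋯ (x+k+1) = x ⋯ (x+k) · (x+k+1) = x · (x+1) ⋯ (x+k+1)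
-- combine the quotients a, b of the induction hypotheses into (a ∸ b) · x ⋯ (x+k+1) = (k+1)! D.
risingProduct∣!* : ∀ k x D → (∀ i → i ≤ k → x + i ∣ D) → risingProduct x k ∣ k ! * D
risingProduct∣!* zero x D x+i∣D =
  subst₂ _∣_ (+-identityʳ x) (sym (+-identityʳ D)) (x+i∣D 0 z≤n)
risingProduct∣!* (suc k) x D x+i∣D
  with risingProduct∣!* k x D (λ i i≤k → x+i∣D i (m≤n⇒m≤1+n i≤k))
     | risingProduct∣!* k (suc x) D (λ i i≤k → subst (_∣ D) (+-suc x i) (x+i∣D (suc i) (s≤s i≤k)))
... | divides a eqa | divides b eqb = divides (a ∸ b) (sym (begin
  (a ∸ b) * P              ≡⟨ *-distribʳ-∸ P a b ⟩
  a * P ∸ b * P            ≡⟨ cong₂ _∸_ aP bP ⟩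
  E * x + E * suc k ∸ E * x ≡⟨ m+n∸m≡n (E * x) (E * suc k) ⟩
  E * suc k                ≡⟨ solve 3 (λ f d s → (f :* d) :* s := (s :* f) :* d) refl (k !) D (suc k) ⟩
  suc k ! * D              ∎))
  where
  open ≡-Reasoning
  E P : ℕ
  E = k ! * D
  P = risingProduct x (suc k)
  aP : a * P ≡ E * x + E * suc k
  aP = begin
    a * (risingProduct x k * (x + suc k)) ≡⟨ *-assoc a _ _ ⟨
    a * risingProduct x k * (x + suc k)   ≡⟨ cong (_* (x + suc k)) eqa ⟨
    E * (x + suc k)                       ≡⟨ *-distribˡ-+ E x (suc k) ⟩
    E * x + E * suc k                     ∎
  bP : b * P ≡ E * x
  bP = begin
    b * P                            ≡⟨ cong (b *_) (risingProduct-suc x k) ⟩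
    b * (x * risingProduct (suc x) k) ≡⟨ solve 3 (λ b x p → b :* (x :* p) := (b :* p) :* x) refl b x (risingProduct (suc x) k) ⟩
    b * risingProduct (suc x) k * x  ≡⟨ cong (_* x) eqb ⟨
    E * x                            ∎

2^k*k!≤risingProduct : ∀ k x → k < x → 2 ^ k * k ! ≤ risingProduct x k
2^k*k!≤risingProduct zero    x 0<x = 0<x
2^k*k!≤risingProduct (suc k) x k<x = begin
  2 ^ suc k * suc k !          ≡⟨ solve 3 (λ t f s → (con 2 :* t) :* (s :* f) := (t :* f) :* (s :+ s)) refl (2 ^ k) (k !) (suc k) ⟩
  2 ^ k * k ! * (suc k + suc k) ≤⟨ *-mono-≤ (2^k*k!≤risingProduct k x (<-trans (n<1+n k) k<x)) (+-monoˡ-≤ (suc k) (<⇒≤ k<x)) ⟩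
  risingProduct x k * (x + suc k) ∎
  where open ≤-Reasoning

2^k≤common-multiple : ∀ k D → 0 < D → (∀ i → i ≤ k → suc k + i ∣ D) → 2 ^ k ≤ D
2^k≤common-multiple k D 0<D k+1+i∣D = *-cancelˡ-≤ (k !) {{k !≢0}} (begin
  k ! * 2 ^ k              ≡⟨ *-comm (k !) _ ⟩
  2 ^ k * k !              ≤⟨ 2^k*k!≤risingProduct k (suc k) ≤-refl ⟩
  risingProduct (suc k) k  ≤⟨ ∣⇒≤ {{k!*D≢0}} (risingProduct∣!* k (suc k) D k+1+i∣D) ⟩
  k ! * D                  ∎)
  where
  open ≤-Reasoning
  k!*D≢0 : NonZero (k ! * D)
  k!*D≢0 = m*n≢0 (k !) D {{k !≢0}} {{>-nonZero 0<D}}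

%≡%⇒∣∣-∣ : ∀ a b d .{{_ : NonZero d}} → a % d ≡ b % d → d ∣ ∣ a - b ∣
%≡%⇒∣∣-∣ a b d a%d≡b%d = divides ∣ a / d - b / d ∣ (begin
  ∣ a - b ∣                                     ≡⟨ cong₂ ∣_-_∣ (m≡m%n+[m/n]*n a d) (m≡m%n+[m/n]*n b d) ⟩
  ∣ a % d + a / d * d - b % d + b / d * d ∣      ≡⟨ cong (λ r → ∣ a % d + a / d * d - r + b / d * d ∣) a%d≡b%d ⟨
  ∣ a % d + a / d * d - a % d + b / d * d ∣      ≡⟨ ∣m+n-m+o∣≡∣n-o∣ (a % d) _ _ ⟩
  ∣ a / d * d - b / d * d ∣                     ≡⟨ *-distribʳ-∣-∣ d (a / d) (b / d) ⟨
  ∣ a / d - b / d ∣ * d                         ∎)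
  where open ≡-Reasoning

-- ∣ a - b ∣ is a common multiple of k+1, …, 2k+1, hence 0 or at least 2 ^ k.
≡-from-residues : ∀ k a b → ∣ a - b ∣ < 2 ^ k →
                  (∀ i → i ≤ k → a % suc (k + i) ≡ b % suc (k + i)) → a ≡ b
≡-from-residues k a b ∣a-b∣<2^k residues with ∣ a - b ∣ in ∣a-b∣≡D
... | zero  = ∣m-n∣≡0⇒m≡n ∣a-b∣≡D
... | suc D = contradiction ∣a-b∣<2^k (≤⇒≯ (2^k≤common-multiple k (suc D) z<s k+1+i∣D))
  where
  k+1+i∣D : ∀ i → i ≤ k → suc k + i ∣ suc D
  k+1+i∣D i i≤k = subst (suc (k + i) ∣_) ∣a-b∣≡D (%≡%⇒∣∣-∣ a b (suc (k + i)) (residues i i≤k))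

∣m-n∣≤n : ∀ m n → m ≤ n + n → ∣ m - n ∣ ≤ n
∣m-n∣≤n m n m≤2n with ∣m-n∣≡[m∸n]∨[n∸m] m n
... | inj₁ eq = subst (_≤ n) (sym eq) (≤-trans (∸-monoˡ-≤ n m≤2n) (≤-reflexive (m+n∸n≡m n n)))
... | inj₂ eq = subst (_≤ n) (sym eq) (m∸n≤m n m)

≢⇔%-≢ : ∀ M a b → ∣ a - b ∣ < 2 ^ M →
        a ≢ b ⇔ (∃[ i ] a % suc (M + toℕ {suc M} i) ≢ b % suc (M + toℕ i))
≢⇔%-≢ M a b ∣a-b∣<2^M = mk⇔ some-residue-differs (λ (i , residues≢) → residues≢ ∘ %-congˡ)
  where
  some-residue-differs : a ≢ b → ∃[ i ] a % suc (M + toℕ {suc M} i) ≢ b % suc (M + toℕ i)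
  some-residue-differs a≢b = ¬∀⟶∃¬ (suc M) _ (λ i → a % suc (M + toℕ i) ≟ b % suc (M + toℕ i))
    λ residues≡ → a≢b (≡-from-residues M a b ∣a-b∣<2^M λ i i≤M →
      subst (λ j → a % suc (M + j) ≡ b % suc (M + j)) (toℕ-fromℕ< (s≤s i≤M)) (residues≡ (fromℕ< (s≤s i≤M))))

n<2^suc⌊log₂n⌋ : ∀ n → n < 2 ^ suc ⌊log₂ n ⌋
n<2^suc⌊log₂n⌋ n with 2 ^ suc ⌊log₂ n ⌋ ≤? n
... | no 2^suc⌊log₂n⌋≰n = ≰⇒> 2^suc⌊log₂n⌋≰n
... | yes 2^suc⌊log₂n⌋≤n = contradiction (⌊log₂⌋-mono-≤ 2^suc⌊log₂n⌋≤n) (<⇒≱ (≤-reflexive (sym (⌊log₂[2^n]⌋≡n _))))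

n≡⌊n/2⌋+⌊n/2⌋ : ∀ n → 2 ∣ n → n ≡ ⌊ n /2⌋ + ⌊ n /2⌋
n≡⌊n/2⌋+⌊n/2⌋ n (divides q refl) = trans q*2≡q+q (cong₂ _+_ q≡⌊q*2/2⌋ q≡⌊q*2/2⌋)
  where
  q*2≡q+q : q * 2 ≡ q + q
  q*2≡q+q = solve 1 (λ q → q :* con 2 := q :+ q) refl q
  q≡⌊q*2/2⌋ : q ≡ ⌊ q * 2 /2⌋
  q≡⌊q*2/2⌋ = trans (n≡⌊n+n/2⌋ q) (cong ⌊_/2⌋ (sym q*2≡q+q))

⌊n/2⌋<2^⌊log₂n⌋ : ∀ n → 2 ∣ n → ⌊ n /2⌋ < 2 ^ ⌊log₂ n ⌋
⌊n/2⌋<2^⌊log₂n⌋ n 2∣n = *-cancelˡ-< 2 ⌊ n /2⌋ (2 ^ ⌊log₂ n ⌋) (begin-strict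
  2 * ⌊ n /2⌋         ≡⟨ cong (⌊ n /2⌋ +_) (+-identityʳ ⌊ n /2⌋) ⟩
  ⌊ n /2⌋ + ⌊ n /2⌋   ≡⟨ n≡⌊n/2⌋+⌊n/2⌋ n 2∣n ⟨
  n                   <⟨ n<2^suc⌊log₂n⌋ n ⟩
  2 ^ suc ⌊log₂ n ⌋   ∎)
  where open ≤-Reasoning

countF-false : ∀ n → countF n (λ _ → false) ≡ 0
countF-false zero    = refl
countF-false (suc n) = countF-false n

countF-<ᵇ : ∀ n k → k ≤ n → countF n (λ i → toℕ i <ᵇ k) ≡ k
countF-<ᵇ n       zero    _         = countF-false n
countF-<ᵇ (suc n) (suc k) (s≤s k≤n) = cong suc (countF-<ᵇ n k k≤n)

countF-split : ∀ n (a b : Fin n → Bool) →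
               countF n (λ i → a i ∧ not (b i)) + countF n (λ i → a i ∧ b i) ≡ countF n a
countF-split zero    a b = refl
countF-split (suc n) a b with a zero | b zero | countF-split n (a ∘ suc) (b ∘ suc)
... | true  | true  | split = trans (+-suc (countF n (λ i → a (suc i) ∧ not (b (suc i)))) _) (cong suc split)
... | true  | false | split = cong suc split
... | false | _     | split = split

#0+#1≡k : ∀ {n} k (ν : Input n) → k ≤ n → #0 k ν + #1 k ν ≡ k
#0+#1≡k {n} k ν k≤n = trans (countF-split n (λ i → toℕ i <ᵇ k) ν) (countF-<ᵇ n k k≤n)

≡ᵇ-reflexive : ∀ {m n} → m ≡ n → (m ≡ᵇ n) ≡ true
≡ᵇ-reflexive {m} {n} m≡n = Equivalence.to T-≡ (≡⇒≡ᵇ m n m≡n)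

≢⇒≡ᵇ-false : ∀ {m n} → m ≢ n → (m ≡ᵇ n) ≡ false
≢⇒≡ᵇ-false {m} {n} m≢n with m ≡ᵇ n in eq
... | true  = contradiction (≡ᵇ⇒≡ m n (Equivalence.from T-≡ eq)) m≢n
... | false = refl

-- For even k ≤ n the k counted bits split into #0 + #1 = k, so #1 = k/2 forces #0 = k/2.
NotO≡true⇔ : ∀ {n} k (ν : Input n) → 2 ∣ k → k ≤ n → NotO n k ν ≡ true ⇔ #1 k ν ≢ ⌊ k /2⌋
NotO≡true⇔ {n} k ν 2∣k k≤n = mk⇔ (λ NotO≡true → not-¬ NotO≡true ∘ NotO≡false) NotO≡true
  where
  h : ℕ
  h = ⌊ k /2⌋
  NotO≡false : #1 k ν ≡ h → NotO n k ν ≡ false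
  NotO≡false #1≡h = cong not (cong₂ _∧_ (≡ᵇ-reflexive #0≡h) (≡ᵇ-reflexive #1≡h))
    where
    #0≡h : #0 k ν ≡ h
    #0≡h = +-cancelʳ-≡ (#1 k ν) (#0 k ν) h
             (trans (#0+#1≡k k ν k≤n) (trans (n≡⌊n/2⌋+⌊n/2⌋ k 2∣k) (cong (h +_) (sym #1≡h))))
  NotO≡true : #1 k ν ≢ h → NotO n k ν ≡ true
  NotO≡true #1≢h = cong not (trans (cong ((#0 k ν ≡ᵇ h) ∧_) (≢⇒≡ᵇ-false #1≢h)) (∧-zeroʳ _))

isYes≡true⇔ : ∀ {a} {A : Set a} (a? : Dec A) → isYes a? ≡ true ⇔ A
isYes≡true⇔ (yes a) = mk⇔ (const a) (const refl)
isYes≡true⇔ (no ¬a) = mk⇔ (λ ()) (⊥-elim ∘ ¬a)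

prefixSum : ∀ {n} → (Fin n → ℕ) → Fin (suc n) → ℕ
prefixSum f zero                = 0
prefixSum {suc n} f (suc ℓ)     = f zero + prefixSum (f ∘ suc) ℓ

prefixSum-suc : ∀ {n} (f : Fin n → ℕ) (j : Fin n) → prefixSum f (suc j) ≡ prefixSum f (inject₁ j) + f j
prefixSum-suc f zero    = +-comm (f zero) 0
prefixSum-suc f (suc j) = trans (cong (f zero +_) (prefixSum-suc (f ∘ suc) j)) (sym (+-assoc (f zero) _ _))

prefixSum-indicator : ∀ n (P : Fin n → Bool) → prefixSum (λ i → if P i then 1 else 0) (fromℕ n) ≡ countF n P
prefixSum-indicator zero    P = refl
prefixSum-indicator (suc n) P = cong ((if P zero then 1 else 0) +_) (prefixSum-indicator n (P ∘ suc))

%-absorbˡ : ∀ a c d .{{_ : NonZero d}} → (a % d + c) % d ≡ (a + c) % d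
%-absorbˡ a c d = begin
  (a % d + c) % d         ≡⟨ %-distribˡ-+ (a % d) c d ⟩
  (a % d % d + c % d) % d ≡⟨ cong (λ r → (r + c % d) % d) (m%n%n≡m%n a d) ⟩
  (a % d + c % d) % d     ≡⟨ %-distribˡ-+ a c d ⟨
  (a + c) % d             ∎
  where open ≡-Reasoning

maxF≤ : ∀ m (f : Fin m → ℕ) b → (∀ i → f i ≤ b) → maxF m f ≤ b
maxF≤ zero    f b f≤b = z≤n
maxF≤ (suc m) f b f≤b = ⊔-lub (f≤b zero) (maxF≤ m (f ∘ suc) b (f≤b ∘ suc))

-- The automaton guesses a modulus on its first edge, then keeps track of the weighted
-- count of the input modulo it; a node of a non-initial level is a pair (modulus index, residue).
module ModularCounter
  (n′ m B : ℕ) (modulus : Fin m → ℕ) {{modulus≢0 : ∀ {i} → NonZero (modulus i)}}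
  (modulus≤B : ∀ i → modulus i ≤ B) (weight : Fin (suc n′) → Bool → ℕ) (target : ℕ)
  where

  n : ℕ
  n = suc n′

  Node : Set
  Node = Fin (m * B)

  index : Node → Fin m
  index u = proj₁ (remQuot {m} B u)

  residue : Node → ℕ
  residue u = toℕ (proj₂ (remQuot {m} B u))

  size : Fin (suc n) → ℕ
  size zero    = 1
  size (suc _) = m * B

  Step : (j : Fin n) → Fin (size (inject₁ j)) → Bool → Fin (size (suc j)) → Set
  Step zero    _ b v = residue v ≡ weight zero b % modulus (index v)
  Step (suc j) u b v = index v ≡ index u × residue v ≡ (residue u + weight (suc j) b) % modulus (index v)

  step? : ∀ j u b v → Dec (Step j u b v)
  step? zero    _ b v = residue v ≟ weight zero b % modulus (index v)
  step? (suc j) u b v = (index v Fin.≟ index u) ×-dec (residue v ≟ (residue u + weight (suc j) b) % modulus (index v))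

  Accepts : Node → Set
  Accepts u = residue u ≢ target % modulus (index u)

  accepts? : ∀ u → Dec (Accepts u)
  accepts? u = ¬? (residue u ≟ target % modulus (index u))

  counter : NOBDD n
  counter = record
    { order     = id
    ; size      = size
    ; singleSrc = refl
    ; edge      = λ j u b v → isYes (step? j u b v)
    ; accepting = isYes ∘ accepts?
    }

  open NOBDD counter using (AcceptingPath)

  total : Input n → ℕ
  total ν = prefixSum (λ j → weight j (ν j)) (fromℕ n)

  module _ (ν : Input n) where
    private
      w : Fin n → ℕ
      w j = weight j (ν j)

    prefixSum-%-suc : ∀ i j → (prefixSum w (suc (inject₁ j)) % modulus i + w (suc j)) % modulus i
                              ≡ prefixSum w (suc (suc j)) % modulus i
    prefixSum-%-suc i j = begin
      (prefixSum w (suc (inject₁ j)) % modulus i + w (suc j)) % modulus i ≡⟨ %-absorbˡ (prefixSum w (suc (inject₁ j))) (w (suc j)) (modulus i) ⟩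
      (prefixSum w (suc (inject₁ j)) + w (suc j)) % modulus i            ≡⟨ %-congˡ (prefixSum-suc w (suc j)) ⟨
      prefixSum w (suc (suc j)) % modulus i                              ∎
      where open ≡-Reasoning

    Invariant : (p : (j : Fin (suc n)) → Fin (size j)) → Fin m → Fin n → Set
    Invariant p i j = index (p (suc j)) ≡ i × residue (p (suc j)) ≡ prefixSum w (suc j) % modulus i

    pathInvariant : (p : (j : Fin (suc n)) → Fin (size j)) →
                    (∀ j → Step j (p (inject₁ j)) (ν j) (p (suc j))) →
                    ∀ j → Invariant p (index (p (suc zero))) j
    pathInvariant p steps = <-weakInduction (Invariant p i) base next
      where
      i : Fin m
      i = index (p (suc zero))
      base : Invariant p i zero
      base = refl , trans (steps zero) (%-congˡ (sym (+-identityʳ (w zero))))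
      next : ∀ j → Invariant p i (inject₁ j) → Invariant p i (suc j)
      next j (index≡i , residue≡) = index≡i′ , (begin
        residue (p (suc (suc j)))                                                       ≡⟨ proj₂ (steps (suc j)) ⟩
        (residue (p (suc (inject₁ j))) + w (suc j)) % modulus (index (p (suc (suc j)))) ≡⟨ cong₂ (λ r (i : Fin m) → (r + w (suc j)) % modulus i) residue≡ index≡i′ ⟩
        (prefixSum w (suc (inject₁ j)) % modulus i + w (suc j)) % modulus i            ≡⟨ prefixSum-%-suc i j ⟩
        prefixSum w (suc (suc j)) % modulus i                                          ∎)
        where
        open ≡-Reasoning
        index≡i′ : index (p (suc (suc j))) ≡ i
        index≡i′ = trans (proj₁ (steps (suc j))) index≡i

    sound : AcceptingPath ν → ∃[ i ] total ν % modulus i ≢ target % modulus i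
    sound (p , edges , accepting) = i , λ total≡target → rejects (begin
      residue (p (fromℕ n))             ≡⟨ residue≡ ⟩
      total ν % modulus i               ≡⟨ total≡target ⟩
      target % modulus i                ≡⟨ cong (λ (i : Fin m) → target % modulus i) index≡i ⟨
      target % modulus (index (p (fromℕ n))) ∎)
      where
      open ≡-Reasoning
      i : Fin m
      i = index (p (suc zero))
      steps : ∀ j → Step j (p (inject₁ j)) (ν j) (p (suc j))
      steps j = Equivalence.to (isYes≡true⇔ (step? j _ _ _)) (edges j)
      index≡i : index (p (fromℕ n)) ≡ i
      index≡i = proj₁ (pathInvariant p steps (fromℕ n′))
      residue≡ : residue (p (fromℕ n)) ≡ total ν % modulus i
      residue≡ = proj₂ (pathInvariant p steps (fromℕ n′))
      rejects : Accepts (p (fromℕ n))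
      rejects = Equivalence.to (isYes≡true⇔ (accepts? _)) accepting

    complete : ∃[ i ] total ν % modulus i ≢ target % modulus i → AcceptingPath ν
    complete (i , total≢target) = p , (λ j → Equivalence.from (isYes≡true⇔ (step? j _ _ _)) (steps j)) ,
                                  Equivalence.from (isYes≡true⇔ (accepts? _)) accepts
      where
      residue<B : ∀ ℓ → prefixSum w (suc ℓ) % modulus i < B
      residue<B ℓ = <-≤-trans (m%n<n _ (modulus i)) (modulus≤B i)
      p : (j : Fin (suc n)) → Fin (size j)
      p zero    = zero
      p (suc ℓ) = combine i (fromℕ< (residue<B ℓ))
      index≡i : ∀ ℓ → index (p (suc ℓ)) ≡ i
      index≡i ℓ = cong proj₁ (remQuot-combine i _)
      residue≡ : ∀ ℓ → residue (p (suc ℓ)) ≡ prefixSum w (suc ℓ) % modulus i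
      residue≡ ℓ = trans (cong (toℕ ∘ proj₂) (remQuot-combine i _)) (toℕ-fromℕ< (residue<B ℓ))
      steps : ∀ j → Step j (p (inject₁ j)) (ν j) (p (suc j))
      steps zero    = begin
        residue (p (suc zero))                       ≡⟨ residue≡ zero ⟩
        (w zero + 0) % modulus i                     ≡⟨ %-congˡ (+-identityʳ (w zero)) ⟩
        w zero % modulus i                           ≡⟨ cong (λ (i : Fin m) → w zero % modulus i) (index≡i zero) ⟨
        w zero % modulus (index (p (suc zero)))      ∎
        where open ≡-Reasoning
      steps (suc j) = trans (index≡i (suc j)) (sym (index≡i (inject₁ j))) , (begin
        residue (p (suc (suc j)))                                                       ≡⟨ residue≡ (suc j) ⟩
        prefixSum w (suc (suc j)) % modulus i                                          ≡⟨ prefixSum-%-suc i j ⟨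
        (prefixSum w (suc (inject₁ j)) % modulus i + w (suc j)) % modulus i            ≡⟨ cong₂ (λ r (i : Fin m) → (r + w (suc j)) % modulus i) (residue≡ (inject₁ j)) (index≡i (suc j)) ⟨
        (residue (p (suc (inject₁ j))) + w (suc j)) % modulus (index (p (suc (suc j))))  ∎)
        where open ≡-Reasoning
      accepts : Accepts (p (fromℕ n))
      accepts residue≡target = total≢target (begin
        total ν % modulus i                          ≡⟨ residue≡ (fromℕ n′) ⟨
        residue (p (fromℕ n))                        ≡⟨ residue≡target ⟩
        target % modulus (index (p (fromℕ n)))       ≡⟨ cong (λ (i : Fin m) → target % modulus i) (index≡i (fromℕ n′)) ⟩
        target % modulus i                           ∎)
        where open ≡-Reasoning

  accepts⇔ : ∀ ν → AcceptingPath ν ⇔ (∃[ i ] total ν % modulus i ≢ target % modulus i)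
  accepts⇔ ν = mk⇔ (sound ν) (complete ν)

  width-counter : 1 ≤ m * B → width counter ≤ m * B
  width-counter 1≤m*B = maxF≤ (suc n) size (m * B) size≤
    where
    size≤ : ∀ j → size j ≤ m * B
    size≤ zero    = 1≤m*B
    size≤ (suc _) = ≤-refl

module NotOCounter (n′ k : ℕ) where
  M : ℕ
  M = ⌊log₂ k ⌋

  modulus : Fin (suc M) → ℕ
  modulus i = suc (M + toℕ i)

  modulus≤2M+1 : ∀ i → modulus i ≤ suc (M + M)
  modulus≤2M+1 i = s≤s (+-monoʳ-≤ M (toℕ≤pred[n] i))

  weight : Fin (suc n′) → Bool → ℕ
  weight j b = if (toℕ j <ᵇ k) ∧ b then 1 else 0

  open ModularCounter n′ (suc M) (suc (M + M)) modulus {{_}} modulus≤2M+1 weight ⌊ k /2⌋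
    public using (counter; accepts⇔; width-counter)

  computes : 2 ∣ k → k ≤ suc n′ → Computes counter (NotO (suc n′) k)
  computes 2∣k k≤n ν = ⇔.trans (NotO≡true⇔ k ν 2∣k k≤n) (⇔.trans (≢⇔%-≢ M (#1 k ν) h ∣#1-h∣<2^M) residue-differs⇔accepts)
    where
    h : ℕ
    h = ⌊ k /2⌋
    #1≤h+h : #1 k ν ≤ h + h
    #1≤h+h = subst (#1 k ν ≤_) (trans (#0+#1≡k k ν k≤n) (n≡⌊n/2⌋+⌊n/2⌋ k 2∣k)) (m≤n+m (#1 k ν) (#0 k ν))
    ∣#1-h∣<2^M : ∣ #1 k ν - h ∣ < 2 ^ M
    ∣#1-h∣<2^M = ≤-<-trans (∣m-n∣≤n (#1 k ν) h #1≤h+h) (⌊n/2⌋<2^⌊log₂n⌋ k 2∣k)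
    residue-differs⇔accepts : (∃[ i ] #1 k ν % modulus i ≢ h % modulus i) ⇔ NOBDD.AcceptingPath counter ν
    residue-differs⇔accepts = subst (λ t → (∃[ i ] t % modulus i ≢ h % modulus i) ⇔ NOBDD.AcceptingPath counter ν)
      (prefixSum-indicator (suc n′) (λ i → (toℕ i <ᵇ k) ∧ ν i)) (⇔.sym (accepts⇔ ν))

  width-bound : 4 ≤ k → width counter ≤ 6 * (M ^ 2 * ⌊log₂ M ⌋)
  width-bound 4≤k = begin
    width counter                 ≤⟨ width-counter z<s ⟩
    suc M * suc (M + M)           ≤⟨ *-mono-≤ 1+M≤M+M (+-monoˡ-≤ M 1+M≤M+M) ⟩
    (M + M) * (M + M + M)         ≡⟨ solve 1 (λ m → (m :+ m) :* ((m :+ m) :+ m) := con 6 :* ((m :* (m :* con 1)) :* con 1)) refl M ⟩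
    6 * (M ^ 2 * 1)               ≤⟨ *-monoʳ-≤ 6 (*-monoʳ-≤ (M ^ 2) (⌊log₂⌋-mono-≤ 2≤M)) ⟩
    6 * (M ^ 2 * ⌊log₂ M ⌋)       ∎
    where
    open ≤-Reasoning
    2≤M : 2 ≤ M
    2≤M = ⌊log₂⌋-mono-≤ 4≤k
    1+M≤M+M : suc M ≤ M + M
    1+M≤M+M = subst (_≤ M + M) (+-comm M 1) (+-monoʳ-≤ M (≤-trans (s≤s z≤n) 2≤M))

lemma5 : Σ ℕ λ C → Σ ℕ λ k₀ → (n k : ℕ) → 2 ∣ k → 1 < k → k ≤ n → k₀ ≤ k →
    Σ (NOBDD n) λ B → Computes B (NotO n k) ×
      (width B ≤ C * (⌊log₂ k ⌋ ^ 2 * ⌊log₂ ⌊log₂ k ⌋ ⌋))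
lemma5 = 6 , 4 , notO-counter
  where
  notO-counter : (n k : ℕ) → 2 ∣ k → 1 < k → k ≤ n → 4 ≤ k →
    Σ (NOBDD n) λ B → Computes B (NotO n k) × (width B ≤ 6 * (⌊log₂ k ⌋ ^ 2 * ⌊log₂ ⌊log₂ k ⌋ ⌋))
  notO-counter zero     k _   _ k≤0 4≤k = contradiction (≤-trans 4≤k k≤0) λ ()
  notO-counter (suc n′) k 2∣k _ k≤n 4≤k = counter , computes 2∣k k≤n , width-bound 4≤k
    where open NotOCounter n′ k
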